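{- Let $G=(V,E)$ be an undirected, unweighted, connected network with girth $g$, let $S\subseteq V$ and let $k$ be a natural number. Let $M$ be the value computed by the procedure Estimate$(G,S,k)$, i.e. $$M=\min\{\, d(s,x)+d(s,y)+1 \;:\; \{x,y\}\in E,\ s\in U(S,k,x)\cap U(S,k,y),\ p(s,x)\neq y,\ p(s,y)\neq x\,\}$$ (with $\min\emptyset=\infty$). Then $g\le M$, and if $\mathcal{C}$ is nonempty then $M\le 2d(S)+g$.
   Context: $d(u,v)$ denotes the hop distance in $G$; each vertex $v$ has a unique identifier $ID(v)$. A vertex $v$ is closer to $u$ than a vertex $w$ if $d(u,v)<d(u,w)$, or $d(u,v)=d(u,w)$ and $ID(v)<ID(w)$. For $v\in V$, $U(S,k,v)$ is the set of the $k$ vertices of $S$ closest to $v$ in this order, or $S$ itself if $|S|\le k$. For $s\in S$ and $v\in U(S,k,v)$-membership, i.e. $s\in U(S,k,v)$ with $v\ne s$, $p(s,v)$ is the parent of $v$ in a BFS tree rooted at $s$ (a neighbor of $v$ with $d(s,p(s,v))=d(s,v)-1$); $p(s,s)$ is undefined (so it differs from every vertex). For a cycle $C$ and vertex $s$, $d(s,C)=\min_{v\in V(C)}d(s,v)$. A source $s\in S$ covers a cycle $C$ if $s\in U(S,k,v)$ for all $v\in V(C)$; $C$ is covered by $S$ if some source covers it, and then $d(S,C)=\min\{d(s,C): s\in S \text{ covers } C\}$. $\mathcal{C}$ is the set of shortest cycles of $G$ covered by $S$, and when $\mathcal{C}\neq\emptyset$, $d(S)=\min\{d(S,C): C\in\mathcal{C}\}$.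 The procedure Estimate$(G,S,k)$: nodes run a source detection algorithm after which each $v$ knows $U(S,k,v)$ with $d(s,v)$ and $p(s,v)$ for $s\in U(S,k,v)$; each node sends this set to its neighbors; each node $y$ computes $M_y$ as the minimum of $d(s,x)+d(s,y)+1$ over neighbors $x$ and $s\in U(S,k,y)\cap U(S,k,x)$ with $p(s,x)\ne y$ and $p(s,y)\ne x$; and $M=\min_v M_v$ is made known to all nodes by convergecast. -}

module Defs where

open import Data.Nat using (ℕ; zero; suc; _+_; _*_; _∸_; _≤_; _<_; _<ᵇ_; _≡ᵇ_)
open import Data.Bool using (Bool; true; false; _∧_; _∨_)
open import Data.Fin using (Fin)
open import Data.Fin.Subset using (Subset; _∈_; ∣_∣)
open import Data.Fin.Subset.Properties using (_∈?_)
open import Data.Vec using (tabulate)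
open import Data.List using (List; []; _∷_; _++_; length)
open import Data.List.Relation.Unary.Unique.Propositional using (Unique)
open import Data.List.Relation.Unary.Linked using (Linked)
open import Data.List.Membership.Propositional renaming (_∈_ to _∈ₗ_)
open import Data.Product using (Σ; ∃; _×_; _,_)
open import Data.Sum using (_⊎_)
open import Data.Empty using (⊥)
open import Relation.Nullary using (¬_; does)
open import Relation.Binary.PropositionalEquality using (_≡_; _≢_)
open import Function.Definitions using (Injective)

data ℕ∞ : Set where
  fin : ℕ → ℕ∞
  ∞   : ℕ∞

data _≤∞_ : ℕ∞ → ℕ∞ → Set where
  fin≤fin : ∀ {a b} → a ≤ b → fin a ≤∞ fin b
  _≤∞∞    : ∀ x → x ≤∞ ∞

_+∞_ : ℕ∞ → ℕ∞ → ℕ∞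
fin a +∞ fin b = fin (a + b)
_     +∞ _     = ∞

IsMinOf : (ℕ → Set) → ℕ∞ → Set
IsMinOf P (fin a) = P a × (∀ b → P b → a ≤ b)
IsMinOf P ∞       = ∀ b → ¬ P b

record Graph (n : ℕ) : Set₁ where
  field
    Adj     : Fin n → Fin n → Set
    sym     : ∀ {u v} → Adj u v → Adj v u
    irrefl  : ∀ {u} → ¬ Adj u u

module _ {n : ℕ} (G : Graph n) where
  open Graph G

  data Walk : Fin n → Fin n → ℕ → Set where
    here : ∀ {u} → Walk u u 0
    step : ∀ {u w v L} → Adj u w → Walk w v L → Walk u v (suc L)

  Connected : Set
  Connected = ∀ u v → ∃ λ L → Walk u v L

  IsHopDistance : (Fin n → Fin n → ℕ) → Set
  IsHopDistance d = ∀ u v → IsMinOf (Walk u v) (fin (d u v))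

  IsCycle : List (Fin n) → Set
  IsCycle []       = ⊥
  IsCycle (v ∷ vs) = 3 ≤ length (v ∷ vs) × Unique (v ∷ vs)
                     × Linked Adj (v ∷ vs ++ v ∷ [])

  IsGirth : ℕ∞ → Set
  IsGirth = IsMinOf (λ a → ∃ λ C → IsCycle C × length C ≡ a)

module _ {n : ℕ} (d : Fin n → Fin n → ℕ) (ID : Fin n → ℕ) where

  closer : Fin n → Fin n → Fin n → Bool
  closer u a b = (d u a <ᵇ d u b) ∨ ((d u a ≡ᵇ d u b) ∧ (ID a <ᵇ ID b))

  -- s ∈ U(S,k,v): s ∈ S and fewer than k elements of S are closer to v than s
  -- (so U(S,k,v) consists of the k closest sources, or all of S if |S| ≤ k)
  InU : Subset n → ℕ → Fin n → Fin n → Set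
  InU S k v s = s ∈ S × ∣ tabulate (λ t → does (t ∈? S) ∧ closer v t s) ∣ < k

module _ {n : ℕ} (G : Graph n) (d : Fin n → Fin n → ℕ) (ID : Fin n → ℕ)
         (S : Subset n) (k : ℕ) where
  open Graph G

  IsParentFun : (Fin n → Fin n → Fin n) → Set
  IsParentFun p = ∀ s v → InU d ID S k v s → v ≢ s →
                  Adj v (p s v) × d s (p s v) ≡ d s v ∸ 1

  -- "p(s,x) ≠ y", where p(s,s) is undefined and differs from every vertex
  ParentNe : (Fin n → Fin n → Fin n) → Fin n → Fin n → Fin n → Set
  ParentNe p s x y = x ≡ s ⊎ p s x ≢ y

  EstimateCand : (Fin n → Fin n → Fin n) → ℕ → Set
  EstimateCand p m = ∃ λ x → ∃ λ y → ∃ λ s →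
    Adj x y × InU d ID S k x s × InU d ID S k y s
    × ParentNe p s x y × ParentNe p s y x
    × m ≡ d s x + d s y + 1

  Covers : Fin n → List (Fin n) → Set
  Covers s C = s ∈ S × (∀ v → v ∈ₗ C → InU d ID S k v s)

  InCalC : ℕ∞ → List (Fin n) → Set
  InCalC g C = IsCycle G C × fin (length C) ≡ g × ∃ λ s → Covers s C

  DistSC : Fin n → List (Fin n) → ℕ → Set
  DistSC s C a = IsMinOf (λ b → ∃ λ v → v ∈ₗ C × b ≡ d s v) (fin a)

  DistSetC : List (Fin n) → ℕ → Set
  DistSetC C a = IsMinOf (λ b → ∃ λ s → Covers s C × DistSC s C b) (fin a)

  IsDS : ℕ∞ → ℕ∞ → Set
  IsDS g = IsMinOf (λ b → ∃ λ C → InCalC g C × DistSetC C b)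

-- Every candidate value of M comes from an edge {x,y} and a source s in U(S,k,x) ∩ U(S,k,y).
-- U(S,k,·) is closed under BFS parents, so x and y can be walked up the BFS tree of s, always
-- moving the endpoint farther from s; this gives a simple x–y path with at most d(s,x)+d(s,y)
-- edges, and the conditions on p make it long enough to close with {x,y} into a cycle: g ≤ M.
-- Conversely, let s cover C ∈ 𝒞 with d(S) = d(s,v), v ∈ C, and let z be a vertex of C farthest
-- from s. One of the two neighbours w of z on C is not p(s,z), and p(s,w) ≠ z as d(s,w) ≤ d(s,z);
-- going around C from z to w through v gives d(s,z)+d(s,w)+1 ≤ 2d(s,v)+|C| = 2d(S)+g.

{-# OPTIONS --safe #-}
module Submission where

open import Defs
open import Data.Bool using (Bool; true; T; _∧_)
open import Data.Bool.Properties using (T-∨; T-∧; T-≡)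
open import Data.Empty using (⊥-elim)
open import Data.Fin using (Fin; _≟_)
open import Data.Fin.Subset using (Subset; ∣_∣)
open import Data.Fin.Subset.Properties using (p⊆q⇒∣p∣≤∣q∣)
open import Data.List using (List; []; _∷_; _++_; _∷ʳ_; [_]; length)
open import Data.List.Extrema.Nat using (argmax; argmax-sel; f[⊥]≤f[argmax]; f[xs]≤f[argmax])
open import Data.List.Membership.Propositional using (_∈_)
open import Data.List.Properties using (++-assoc)
open import Data.List.Relation.Unary.All as All using (All; []; _∷_)
open import Data.List.Relation.Unary.AllPairs using ([]; _∷_)
open import Data.List.Relation.Unary.Any using (here; there)
open import Data.List.Relation.Unary.Linked using (Linked; [-]; _∷_)
open import Data.List.Relation.Unary.Unique.Propositional using (Unique)
import Data.List.Relation.Binary.Permutation.Setoid as Permutation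
import Data.List.Relation.Binary.Permutation.Setoid.Properties as PermutationProperties
open import Data.Nat using (ℕ; zero; suc; _+_; _⊔_; _≤_; _<_; z≤n; s≤s; _≤?_)
open import Data.Nat.Properties hiding (_≟_)
open import Algebra.Properties.CommutativeSemigroup +-commutativeSemigroup using (interchange)
open import Data.Product as Product using (∃; ∃₂; _×_; _,_; proj₁; proj₂)
open import Data.Sum as Sum using (_⊎_; inj₁; inj₂)
open import Data.Vec using (tabulate)
open import Data.Vec.Properties using ([]=⇒lookup; lookup⇒[]=; lookup∘tabulate)
open import Function using (_∘_)
open import Function.Bundles using (Equivalence)
open import Function.Definitions using (Injective)
open import Relation.Nullary using (¬_; yes; no)
open import Relation.Binary.PropositionalEquality
  using (_≡_; _≢_; refl; sym; trans; cong; subst; subst₂; ≢-sym)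
open import Relation.Binary.PropositionalEquality.Properties using (setoid)

module Walks {n : ℕ} (G : Graph n) where
  open Graph G renaming (sym to Adj-sym)
  open Permutation (setoid (Fin n)) using (_↭_; ↭-refl; ↭-prep; ↭-trans)
  open PermutationProperties (setoid (Fin n)) using (++-comm; ∷↭∷ʳ)

  private variable
    a b u v w x y z : Fin n
    L L′ : ℕ
    ps us vs : List (Fin n)

  snocWalk : Walk G u v L → Adj v w → Walk G u w (suc L)
  snocWalk here          v~w = step v~w here
  snocWalk (step u~x ws) v~w = step u~x (snocWalk ws v~w)

  reverseWalk : Walk G u v L → Walk G v u L
  reverseWalk here          = here
  reverseWalk (step u~w ws) = snocWalk (reverseWalk ws) (Adj-sym u~w)

  _++ʷ_ : Walk G u v L → Walk G v w L′ → Walk G u w (L + L′)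
  here        ++ʷ ws′ = ws′
  step u~x ws ++ʷ ws′ = step u~x (ws ++ʷ ws′)

  -- A walk from x to y recorded by its vertices x ∷ vs; it has length vs edges.
  data Chain : Fin n → Fin n → List (Fin n) → Set where
    [-] : Chain x x []
    _∷_ : Adj x y → Chain y z vs → Chain x z (y ∷ vs)

  chain⇒walk : Chain x y vs → Walk G x y (length vs)
  chain⇒walk [-]           = here
  chain⇒walk (x~w ∷ chain) = step x~w (chain⇒walk chain)

  chain⇒linked : Chain x y vs → Linked Adj (x ∷ vs)
  chain⇒linked [-]           = [-]
  chain⇒linked (x~w ∷ chain) = x~w ∷ chain⇒linked chain

  linked-∷ʳ⇒chain : Linked Adj (x ∷ vs ∷ʳ z) → ∃ λ y → Chain x y vs × Adj y z
  linked-∷ʳ⇒chain {vs = []}    (x~z ∷ [-]) = _ , [-] , x~z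
  linked-∷ʳ⇒chain {vs = _ ∷ _} (x~w ∷ linked) =
    Product.map₂ (Product.map₁ (x~w ∷_)) (linked-∷ʳ⇒chain linked)

  chain-++ : Chain x y vs → Adj y z → Chain z w us → Chain x w (vs ++ z ∷ us)
  chain-++ [-]           y~z chain′ = y~z ∷ chain′
  chain-++ (x~u ∷ chain) y~z chain′ = x~u ∷ chain-++ chain y~z chain′

  chain-∷ʳ : Chain x y vs → Adj y z → Chain x z (vs ∷ʳ z)
  chain-∷ʳ chain y~z = chain-++ chain y~z [-]

  chain-reverse : Chain x y vs → ∃ λ us → Chain y x us × x ∷ vs ↭ y ∷ us
  chain-reverse [-] = [] , [-] , ↭-refl
  chain-reverse {x = x} (x~w ∷ chain) with chain-reverse chain
  ... | us , chain′ , perm =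
    us ∷ʳ x , chain-∷ʳ chain′ (Adj-sym x~w) , ↭-trans (↭-prep x perm) (∷↭∷ʳ x (_ ∷ us))

  chain-last∈ : Chain x y vs → y ∈ x ∷ vs
  chain-last∈ [-]         = here refl
  chain-last∈ (_ ∷ chain) = there (chain-last∈ chain)

  chain-nonempty : Chain x y vs → x ≢ y → 1 ≤ length vs
  chain-nonempty [-]     x≢x = ⊥-elim (x≢x refl)
  chain-nonempty (_ ∷ _) _   = s≤s z≤n

  chain-ends-distinct : Chain x y vs → Unique (x ∷ vs) → 1 ≤ length vs → x ≢ y
  chain-ends-distinct (_ ∷ chain) (x∉ ∷ _) _ = All.lookup x∉ (chain-last∈ chain)

  chain-split : Chain x y vs → v ∈ x ∷ vs →
                ∃₂ λ l₁ l₂ → Walk G x v l₁ × Walk G v y l₂ × l₁ + l₂ ≡ length vs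
  chain-split chain         (here refl) = 0 , _ , here , chain⇒walk chain , refl
  chain-split (x~w ∷ chain) (there v∈)  with chain-split chain v∈
  ... | l₁ , l₂ , ws₁ , ws₂ , l₁+l₂≡ = suc l₁ , l₂ , step x~w ws₁ , ws₂ , cong suc l₁+l₂≡

  chain-cycle : Chain x y vs → Adj y x → Unique (x ∷ vs) → 2 ≤ length vs → IsCycle G (x ∷ vs)
  chain-cycle chain y~x unique long = s≤s long , unique , chain⇒linked (chain-∷ʳ chain y~x)

  cycle-chain : IsCycle G (x ∷ vs) → ∃ λ y → Chain x y vs × Adj y x
  cycle-chain (_ , _ , linked) = linked-∷ʳ⇒chain linked

  private
    rotate-after : Chain a b ps → Adj b x → Chain x y vs → Adj y a → z ∈ x ∷ vs →
                   ∃₂ λ z⁻ us → Chain z z⁻ us × Adj z⁻ z × (a ∷ ps) ++ (x ∷ vs) ↭ z ∷ us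
    rotate-after {a = a} {ps = ps} {vs = vs} prefix b~x chain y~a (here refl) =
      _ , vs ++ a ∷ ps , chain-++ chain y~a prefix , b~x , ++-comm (a ∷ ps) (_ ∷ vs)
    rotate-after {a = a} {ps = ps} {x = x} {z = z} prefix b~x (x~w ∷ chain) y~a (there z∈)
      with rotate-after (chain-∷ʳ prefix b~x) x~w chain y~a z∈
    ... | z⁻ , us , chain′ , z⁻~z , perm =
      z⁻ , us , chain′ , z⁻~z , subst (_↭ z ∷ us) (++-assoc (a ∷ ps) [ x ] _) perm

  rotate : Chain x y vs → Adj y x → z ∈ x ∷ vs →
           ∃₂ λ z⁻ us → Chain z z⁻ us × Adj z⁻ z × x ∷ vs ↭ z ∷ us
  rotate chain         y~x (here refl) = _ , _ , chain , y~x , ↭-refl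
  rotate (x~w ∷ chain) y~x (there z∈)  = rotate-after [-] x~w chain y~x z∈

module Distance {n : ℕ} {G : Graph n} {d : Fin n → Fin n → ℕ} (hop : IsHopDistance G d) where
  open Graph G using (Adj)
  open Walks G

  private variable
    u v w : Fin n
    L : ℕ

  d-walk : ∀ u v → Walk G u v (d u v)
  d-walk u v = proj₁ (hop u v)

  d-minimal : Walk G u v L → d u v ≤ L
  d-minimal {u} {v} {L} ws = proj₂ (hop u v) L ws

  d-sym : ∀ u v → d u v ≡ d v u
  d-sym u v = ≤-antisym (d-minimal (reverseWalk (d-walk v u)))
                        (d-minimal (reverseWalk (d-walk u v)))

  d-self : ∀ u → d u u ≡ 0
  d-self u = n≤0⇒n≡0 (d-minimal here)

  d≡0⇒≡ : d u v ≡ 0 → u ≡ v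
  d≡0⇒≡ {u} {v} d≡0 = walk₀ (subst (Walk G u v) d≡0 (d-walk u v))
    where
      walk₀ : Walk G u v 0 → u ≡ v
      walk₀ here = refl

  d-via : Walk G v w L → d u w ≤ d u v + L
  d-via {v} {u = u} ws = d-minimal (d-walk u v ++ʷ ws)

  d-step : Adj u w → d u v ≤ suc (d w v)
  d-step {w = w} {v} u~w = d-minimal (step u~w (d-walk w v))

IsMinOf-≤ : ∀ {P : ℕ → Set} {M a b} → IsMinOf P M → P a → a ≤ b → M ≤∞ fin b
IsMinOf-≤ {M = fin m} (_ , m-least) Pa a≤b = fin≤fin (≤-trans (m-least _ Pa) a≤b)
IsMinOf-≤ {M = ∞}     none          Pa _   = ⊥-elim (none _ Pa)

∧-monoʳ : ∀ {a b c} → (T b → T c) → T (a ∧ b) → T (a ∧ c)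
∧-monoʳ {true} b⇒c = b⇒c

∣tabulate∣-mono : ∀ {m} {f g : Fin m → Bool} → (∀ i → T (f i) → T (g i)) →
                  ∣ tabulate f ∣ ≤ ∣ tabulate g ∣
∣tabulate∣-mono {f = f} {g} f⇒g = p⊆q⇒∣p∣≤∣q∣ {p = tabulate f} {q = tabulate g} λ {i} i∈f →
  lookup⇒[]= i (tabulate g) (trans (lookup∘tabulate g i) (Equivalence.to T-≡
    (f⇒g i (Equivalence.from T-≡ (trans (sym (lookup∘tabulate f i)) ([]=⇒lookup i∈f))))))

module Estimate {n : ℕ} (G : Graph n) (d : Fin n → Fin n → ℕ) (hop : IsHopDistance G d)
                (ID : Fin n → ℕ) (S : Subset n) (k : ℕ)
                (p : Fin n → Fin n → Fin n) (par : IsParentFun G d ID S k p) where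
  open Graph G renaming (sym to Adj-sym)
  open Walks G
  open Distance hop
  open Permutation (setoid (Fin n)) using (_↭_; ↭-sym)
  open PermutationProperties (setoid (Fin n))
    using (∈-resp-↭; All-resp-↭; Unique-resp-↭; xs↭ys⇒|xs|≡|ys|; ∷↭∷ʳ)

  private variable
    u v w x y z z⁻ : Fin n
    vs : List (Fin n)

  Closer : Fin n → Fin n → Fin n → Set
  Closer u a b = d u a < d u b ⊎ (d u a ≡ d u b × ID a < ID b)

  closer⇒Closer : T (closer d ID u v w) → Closer u v w
  closer⇒Closer =
    Sum.map (<ᵇ⇒< _ _) (Product.map (≡ᵇ⇒≡ _ _) (<ᵇ⇒< _ _) ∘ Equivalence.to T-∧)
    ∘ Equivalence.to T-∨

  Closer⇒closer : Closer u v w → T (closer d ID u v w)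
  Closer⇒closer =
    Equivalence.from T-∨
    ∘ Sum.map <⇒<ᵇ (Equivalence.from T-∧ ∘ Product.map (≡⇒≡ᵇ _ _) <⇒<ᵇ)

  Closer-toward : Adj v w → d v x ≡ suc (d w x) → Closer w y x → Closer v y x
  Closer-toward {v} {w} {x} {y} v~w dvx (inj₁ dwy<dwx) = inj₁ (begin-strict
    d v y        ≤⟨ d-step v~w ⟩
    suc (d w y)  ≤⟨ dwy<dwx ⟩
    d w x        <⟨ n<1+n _ ⟩
    suc (d w x)  ≡⟨ sym dvx ⟩
    d v x        ∎)
    where open ≤-Reasoning
  Closer-toward {v} {w} {x} {y} v~w dvx (inj₂ (dwy≡dwx , id<)) =
    Sum.map₂ (_, id<) (m≤n⇒m<n∨m≡n (≤-trans (d-step v~w)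
                                     (≤-reflexive (trans (cong suc dwy≡dwx) (sym dvx)))))

  Cand : ℕ → Set
  Cand = EstimateCand G d ID S k p

  module FromSource (s : Fin n) where
    D : Fin n → ℕ
    D = d s

    InTree : Fin n → Set
    InTree v = InU d ID S k v s

    ParentEdge : Fin n → Fin n → Set
    ParentEdge x y = x ≢ s × p s x ≡ y

    parent-adj : InTree v → v ≢ s → Adj v (p s v)
    parent-adj {v} v∈ v≢s = proj₁ (par s v v∈ v≢s)

    parent-dist : InTree v → v ≢ s → D v ≡ suc (D (p s v))
    parent-dist {v} v∈ v≢s with D v in dv | proj₂ (par s v v∈ v≢s)
    ... | zero  | _     = ⊥-elim (v≢s (sym (d≡0⇒≡ dv)))
    ... | suc _ | dp≡dv = cong suc (sym dp≡dv)

    parent-closer : InTree v → v ≢ s → D (p s v) < D v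
    parent-closer v∈ v≢s = ≤-reflexive (sym (parent-dist v∈ v≢s))

    -- A source closer than s to p(s,v) is also closer than s to v, so s keeps its rank.
    InTree-parent : InTree v → v ≢ s → InTree (p s v)
    InTree-parent {v} v∈@(s∈S , few) v≢s =
      s∈S , ≤-<-trans (∣tabulate∣-mono (λ t → ∧-monoʳ (closer-child t))) few
      where
        dvs : d v s ≡ suc (d (p s v) s)
        dvs = trans (d-sym v s) (trans (parent-dist v∈ v≢s) (cong suc (d-sym s (p s v))))

        closer-child : ∀ t → T (closer d ID (p s v) t s) → T (closer d ID v t s)
        closer-child t = Closer⇒closer ∘ Closer-toward (parent-adj v∈ v≢s) dvs ∘ closer⇒Closer

    ParentNe⇒¬ParentEdge : ParentNe G d ID S k p s x y → ¬ ParentEdge x y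
    ParentNe⇒¬ParentEdge (inj₁ x≡s)  (x≢s , _)    = x≢s x≡s
    ParentNe⇒¬ParentEdge (inj₂ px≢y) (_ , px≡y)   = px≢y px≡y

    farther-ParentNe : InTree w → D w ≤ D z → ParentNe G d ID S k p s w z
    farther-ParentNe {w} w∈ w≤z with w ≟ s
    ... | yes w≡s = inj₁ w≡s
    ... | no  w≢s = inj₂ λ pw≡z → <-irrefl (cong D pw≡z) (<-≤-trans (parent-closer w∈ w≢s) w≤z)

    farther⇒≢s : D y ≤ D x → x ≢ y → x ≢ s
    farther⇒≢s y≤x x≢y refl = x≢y (d≡0⇒≡ (n≤0⇒n≡0 (≤-trans y≤x (≤-reflexive (d-self s)))))

    Inside : Fin n → Fin n → Fin n → Set
    Inside x y w = w ≡ x ⊎ w ≡ y ⊎ D w < D x ⊔ D y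

    Inside-swap : Inside x y w → Inside y x w
    Inside-swap         (inj₁ w≡x)         = inj₂ (inj₁ w≡x)
    Inside-swap         (inj₂ (inj₁ w≡y))  = inj₁ w≡y
    Inside-swap {x} {y} (inj₂ (inj₂ w<))   = inj₂ (inj₂ (subst (_ <_) (⊔-comm (D x) (D y)) w<))

    -- `inside` is the invariant that keeps the vertices distinct as the path is extended.
    record TreePath (x y : Fin n) : Set where
      field
        {tail}        : List (Fin n)
        chain         : Chain x y tail
        unique        : Unique (x ∷ tail)
        short         : length tail ≤ D x + D y
        inside        : All (Inside x y) (x ∷ tail)
        nondegenerate : 2 ≤ length tail ⊎ x ≡ y ⊎ ParentEdge x y ⊎ ParentEdge y x

    treePath-refl : TreePath x x
    treePath-refl = record
      { chain = [-] ; unique = [] ∷ [] ; short = z≤n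
      ; inside = inj₁ refl ∷ [] ; nondegenerate = inj₂ (inj₁ refl) }

    treePath-swap : TreePath x y → TreePath y x
    treePath-swap {x} {y} path with chain-reverse (TreePath.chain path)
    ... | us , chain′ , perm = record
      { chain         = chain′
      ; unique        = Unique-resp-↭ perm unique
      ; short         = subst₂ _≤_ same-length (+-comm (D x) (D y)) short
      ; inside        = All.map Inside-swap (All-resp-↭ (subst _) perm inside)
      ; nondegenerate = Sum.map (subst (2 ≤_) same-length) (Sum.map sym Sum.swap) nondegenerate
      }
      where
        open TreePath path
        same-length : length tail ≡ length us
        same-length = suc-injective (xs↭ys⇒|xs|≡|ys| perm)

    treePath-parent : InTree x → x ≢ s → TreePath x (p s x)
    treePath-parent {x} x∈ x≢s = record
      { chain = parent-adj x∈ x≢s ∷ [-]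
      ; unique = (x≢px ∷ []) ∷ [] ∷ []
      ; short = ≤-trans (≤-trans (s≤s z≤n) (parent-closer x∈ x≢s)) (m≤m+n (D x) _)
      ; inside = inj₁ refl ∷ inj₂ (inj₁ refl) ∷ []
      ; nondegenerate = inj₂ (inj₂ (inj₁ (x≢s , refl)))
      }
      where
        x≢px : x ≢ p s x
        x≢px x≡px = <-irrefl (cong D (sym x≡px)) (parent-closer x∈ x≢s)

    treePath-extend : InTree x → x ≢ s → D y ≤ D x → x ≢ y → p s x ≢ y →
                      TreePath (p s x) y → TreePath x y
    treePath-extend {x} {y} x∈ x≢s y≤x x≢y px≢y path = record
      { chain         = parent-adj x∈ x≢s ∷ chain
      ; unique        = All.map x∉ inside ∷ unique
      ; short         = ≤-trans (s≤s short) (+-monoˡ-≤ (D y) px<x)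
      ; inside        = inj₁ refl ∷ All.map widen inside
      ; nondegenerate = inj₁ (s≤s (chain-nonempty chain px≢y))
      }
      where
        open TreePath path
        px<x : D (p s x) < D x
        px<x = parent-closer x∈ x≢s

        ⊔≤x : D (p s x) ⊔ D y ≤ D x
        ⊔≤x = ⊔-lub (<⇒≤ px<x) y≤x

        x∉ : Inside (p s x) y w → x ≢ w
        x∉ (inj₁ w≡px)        x≡w  = <-irrefl (cong D (sym (trans x≡w w≡px))) px<x
        x∉ (inj₂ (inj₁ w≡y))  x≡w  = x≢y (trans x≡w w≡y)
        x∉ (inj₂ (inj₂ w<))   refl = <-irrefl refl (<-≤-trans w< ⊔≤x)

        widen : Inside (p s x) y w → Inside x y w
        widen (inj₁ refl)        = inj₂ (inj₂ (<-≤-trans px<x (m≤m⊔n (D x) (D y))))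
        widen (inj₂ (inj₁ w≡y))  = inj₂ (inj₁ w≡y)
        widen (inj₂ (inj₂ w<))   = inj₂ (inj₂ (<-≤-trans w< (≤-trans ⊔≤x (m≤m⊔n (D x) (D y)))))

    treePath   : ∀ N x y → D x + D y < N → InTree x → InTree y → TreePath x y
    treePath-↑ : ∀ N x y → D x + D y < suc N → D y ≤ D x → x ≢ y →
                 InTree x → InTree y → TreePath x y

    treePath (suc N) x y bound x∈ y∈ with x ≟ y | D y ≤? D x
    ... | yes refl | _       = treePath-refl
    ... | no x≢y   | yes y≤x = treePath-↑ N x y bound y≤x x≢y x∈ y∈
    ... | no x≢y   | no  y≰x = treePath-swap (treePath-↑ N y x
            (subst (_< suc N) (+-comm (D x) (D y)) bound) (<⇒≤ (≰⇒> y≰x)) (≢-sym x≢y) y∈ x∈)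

    treePath-↑ N x y bound y≤x x≢y x∈ y∈ with p s x ≟ y
    ... | yes refl = treePath-parent x∈ (farther⇒≢s y≤x x≢y)
    ... | no px≢y  = treePath-extend x∈ x≢s y≤x x≢y px≢y
                       (treePath N (p s x) y bound′ (InTree-parent x∈ x≢s) y∈)
      where
        x≢s : x ≢ s
        x≢s = farther⇒≢s y≤x x≢y

        bound′ : D (p s x) + D y < N
        bound′ = <-≤-trans (+-monoˡ-< (D y) (parent-closer x∈ x≢s)) (≤-pred bound)

    cycle-through-edge : Adj x y → InTree x → InTree y →
                         ParentNe G d ID S k p s x y → ParentNe G d ID S k p s y x →
                         ∃ λ C → IsCycle G C × length C ≤ D x + D y + 1
    cycle-through-edge {x} {y} x~y x∈ y∈ x↛y y↛x =
      x ∷ tail , chain-cycle chain (Adj-sym x~y) unique long ,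
      ≤-trans (s≤s short) (≤-reflexive (+-comm 1 (D x + D y)))
      where
        open TreePath (treePath (suc (D x + D y)) x y ≤-refl x∈ y∈)
        long : 2 ≤ length tail
        long with nondegenerate
        ... | inj₁ long                 = long
        ... | inj₂ (inj₁ refl)          = ⊥-elim (irrefl x~y)
        ... | inj₂ (inj₂ (inj₁ x→y))    = ⊥-elim (ParentNe⇒¬ParentEdge x↛y x→y)
        ... | inj₂ (inj₂ (inj₂ y→x))    = ⊥-elim (ParentNe⇒¬ParentEdge y↛x y→x)

    chain-bound : Chain x y vs → v ∈ x ∷ vs → D x + D y + 1 ≤ D v + D v + length (x ∷ vs)
    chain-bound {x} {y} {vs} {v} chain v∈ with chain-split chain v∈
    ... | l₁ , l₂ , ws₁ , ws₂ , l₁+l₂≡ = begin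
      D x + D y + 1                 ≤⟨ +-monoˡ-≤ 1 (+-mono-≤ (d-via (reverseWalk ws₁)) (d-via ws₂)) ⟩
      (D v + l₁) + (D v + l₂) + 1   ≡⟨ cong (_+ 1) (interchange (D v) l₁ (D v) l₂) ⟩
      (D v + D v) + (l₁ + l₂) + 1   ≡⟨ +-assoc (D v + D v) (l₁ + l₂) 1 ⟩
      (D v + D v) + (l₁ + l₂ + 1)   ≡⟨ cong ((D v + D v) +_) (trans (+-comm _ 1) (cong suc l₁+l₂≡)) ⟩
      D v + D v + length (x ∷ vs)   ∎
      where open ≤-Reasoning

    edge-candidate : Adj x y → InTree x → InTree y →
                     ParentNe G d ID S k p s x y → ParentNe G d ID S k p s y x →
                     Cand (D x + D y + 1)
    edge-candidate x~y x∈ y∈ x↛y y↛x = _ , _ , s , x~y , x∈ , y∈ , x↛y , y↛x , refl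

    candidate-at-farthest : Chain z z⁻ vs → Adj z⁻ z → Unique (z ∷ vs) → 2 ≤ length vs →
                            All (λ w → InTree w × D w ≤ D z) (z ∷ vs) → v ∈ z ∷ vs →
                            ∃ λ m → Cand m × m ≤ D v + D v + length (z ∷ vs)
    candidate-at-farthest {z} {z⁻} {z⁺ ∷ rest} {v} (z~z⁺ ∷ chain⁺) z⁻~z (_ ∷ unique⁺) (s≤s long)
                          farthest@((z∈ , _) ∷ (z⁺∈ , z⁺≤z) ∷ _) v∈ with p s z ≟ z⁻
    ... | no pz≢z⁻ =
      _ , edge-candidate (Adj-sym z⁻~z) z∈ (proj₁ z⁻-far) (inj₂ pz≢z⁻)
            (Product.uncurry farther-ParentNe z⁻-far) ,
      chain-bound (z~z⁺ ∷ chain⁺) v∈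
      where
        z⁻-far : InTree z⁻ × D z⁻ ≤ D z
        z⁻-far = All.lookup farthest (chain-last∈ (z~z⁺ ∷ chain⁺))
    ... | yes pz≡z⁻ =
      _ , edge-candidate (Adj-sym z~z⁺) z⁺∈ z∈ (farther-ParentNe z⁺∈ z⁺≤z) (inj₂ pz≢z⁺) ,
      subst (λ L → D z⁺ + D z + 1 ≤ D v + D v + L) (xs↭ys⇒|xs|≡|ys| (↭-sym rotated))
        (chain-bound (chain-∷ʳ chain⁺ z⁻~z) (∈-resp-↭ rotated v∈))
      where
        pz≢z⁺ : p s z ≢ z⁺
        pz≢z⁺ pz≡z⁺ = chain-ends-distinct chain⁺ unique⁺ long (trans (sym pz≡z⁺) pz≡z⁻)

        rotated : z ∷ z⁺ ∷ rest ↭ z⁺ ∷ rest ∷ʳ z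
        rotated = ∷↭∷ʳ z (z⁺ ∷ rest)

    candidate-on-cycle : ∀ {C} → IsCycle G C → (∀ w → w ∈ C → InTree w) → v ∈ C →
                         ∃ λ m → Cand m × m ≤ D v + D v + length C
    candidate-on-cycle {v} {c ∷ cs} cycle@(three , unique , _) covered v∈ =
      let _ , chain , y~c              = cycle-chain cycle
          _ , us , chain′ , z⁻~z , perm = rotate chain y~c far∈
          same-length                   = xs↭ys⇒|xs|≡|ys| perm
          m , candidate , m≤            = candidate-at-farthest chain′ z⁻~z
            (Unique-resp-↭ perm unique)
            (≤-pred (≤-trans three (≤-reflexive same-length)))
            (All-resp-↭ (subst _) perm (All.tabulate λ {w} w∈ → covered w w∈ , All.lookup max w∈))
            (∈-resp-↭ perm v∈)
      in m , candidate , subst (λ L → m ≤ D v + D v + L) (sym same-length) m≤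
      where
        far : Fin n
        far = argmax D c cs

        far∈ : far ∈ c ∷ cs
        far∈ = Sum.[ here , there ]′ (argmax-sel D c cs)

        max : All (λ w → D w ≤ D far) (c ∷ cs)
        max = f[⊥]≤f[argmax] {f = D} c cs ∷ f[xs]≤f[argmax] {f = D} c cs

  open FromSource

  girth≤estimate : ∀ {g M} → IsGirth G g → IsMinOf Cand M → g ≤∞ M
  girth≤estimate {M = ∞} _ _ = _ ≤∞∞
  girth≤estimate {M = fin _} g-min ((x , y , s , x~y , x∈ , y∈ , x↛y , y↛x , refl) , _)
    with cycle-through-edge s x~y x∈ y∈ x↛y y↛x
  ... | C , cycle , C≤ = IsMinOf-≤ g-min (C , cycle , refl) C≤

  estimate≤ : ∀ {g M dS} → IsMinOf Cand M → IsDS G d ID S k g dS → M ≤∞ ((dS +∞ dS) +∞ g)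
  estimate≤ {dS = ∞} _ _ = _ ≤∞∞
  estimate≤ {dS = fin _} M-min
            ((C , (cycle , refl , _) , ((s , (_ , covered) , ((v , v∈ , refl) , _)) , _)) , _)
    with candidate-on-cycle s cycle covered v∈
  ... | m , candidate , m≤ = IsMinOf-≤ M-min candidate m≤

lemma2 : (n : ℕ) (G : Graph n) → Connected G →
    (d : Fin n → Fin n → ℕ) → IsHopDistance G d →
    (ID : Fin n → ℕ) → Injective _≡_ _≡_ ID →
    (g : ℕ∞) → IsGirth G g →
    (S : Subset n) (k : ℕ) →
    (p : Fin n → Fin n → Fin n) → IsParentFun G d ID S k p →
    (M : ℕ∞) → IsMinOf (EstimateCand G d ID S k p) M →
    (g ≤∞ M) ×
    ((∃ λ C → InCalC G d ID S k g C) →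
    (dS : ℕ∞) → IsDS G d ID S k g dS →
    M ≤∞ ((dS +∞ dS) +∞ g))
lemma2 _ G _ d hop ID _ g g-min S k p par M M-min =
  girth≤estimate g-min M-min , λ _ dS dS-min → estimate≤ M-min dS-min
  where open Estimate G d hop ID S k p par
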